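{- Let $G$ be a 2-edge-connected graph with DFS tree $T$ rooted at $r$ and chain decomposition $C_1,C_2,\ldots$, such that $C_1\cup C_2$ is a subdivision of the graph with two vertices and three parallel edges, with branch vertices $r$ and $t(C_2)$. Let $G_c$ be a parent-closed union of chains that contains $C_1$ and $C_2$, let $C$ be a chain contained in $G_c$, and let $D$ be an interlacing child of $C$ not contained in $G_c$. Then $D$ is a Mader-path with respect to $G_c$.
   Context: Graphs are finite, undirected, may have parallel edges, no self-loops, minimum degree at least three. $T$ is a DFS tree rooted at $r$; $x\le y$ means $x$ lies on the tree path from $r$ to $y$; $p(v)$ is the parent of $v\ne r$. Non-tree edges (back-edges) join a vertex to a proper ancestor and are oriented from the ancestor. Chain decomposition: processing vertices $v$ in DFS discovery order, declare $v$ visited, then for each back-edge from $v$ to $w$ walk the tree path from $w$ towards $r$ until the first visited vertex $x$; the back-edge plus the tree path from $w$ to $x$ is a chain with source $v$ and target $x$; its inner vertices are declared visited. Chains are numbered in construction order and partition $E(G)$. $r$ s-belongs to $C_1$; $v\ne r$ s-belongs to the chain containing $\{v,p(v)\}$. The parent of a chain $D\ne C_1$ is the chain to which $t(D)$ s-belongs; $D$ is then a child of that chain. A child $D$ of chain $C$ is interlacing if $s(C)\le s(D)\le t(C)$. A union of chains $G_c$ is parent-closed if for every chain $D\ne C_1$ in $G_c$ its parent is in $G_c$. Branch vertices of $H$: degree at least three in $H$; a link of $H$: maximal path whose inner vertices have degree two in $H$. An ear of $H$: path with endpoints in $H$ and inner vertices and edges not in $H$. A Mader-path with respect to $H$: an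 ear of $H$ whose endpoints are not both inner vertices of the same link of $H$. -}

module Defs where

open import Data.Nat using (ℕ; zero; suc; _≤_; _<_)
open import Data.Fin using (Fin; _≟_)
open import Data.List using (List; []; _∷_; length; filter; allFin)
open import Data.List.Membership.Propositional using (_∈_; _∉_)
open import Data.List.Relation.Unary.Unique.Propositional using (Unique)
open import Data.List.Relation.Unary.All using (All)
open import Data.Product using (Σ; ∃; ∃-syntax; _×_; _,_)
open import Data.Sum using (_⊎_)
open import Relation.Nullary using (¬_)
open import Relation.Nullary.Decidable using (_⊎-dec_)
open import Relation.Binary.PropositionalEquality using (_≡_; _≢_)
open import Function.Bundles using (_⇔_)

-- Finite multigraphs: vertices Fin n, edges Fin m, edge e has ends
-- end₁ e and end₂ e (parallel edges allowed).

record Graph : Set where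
  field
    n m : ℕ
    end₁ end₂ : Fin m → Fin n

module _ (G : Graph) where
  open Graph G

  Vertex : Set
  Vertex = Fin n

  Edge : Set
  Edge = Fin m

  Incident : Edge → Vertex → Set
  Incident e v = end₁ e ≡ v ⊎ end₂ e ≡ v

  Joins : Edge → Vertex → Vertex → Set
  Joins e u v = (end₁ e ≡ u × end₂ e ≡ v) ⊎ (end₂ e ≡ u × end₁ e ≡ v)

  Loopless : Set
  Loopless = ∀ e → end₁ e ≢ end₂ e

  -- number of edges incident with v (no loops, so each counts once)
  degree : Vertex → ℕ
  degree v = length (filter (λ e → (end₁ e ≟ v) ⊎-dec (end₂ e ≟ v)) (allFin m))

  MinDegree3 : Set
  MinDegree3 = ∀ v → 3 ≤ degree v

  data Walk : Vertex → Vertex → Set where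
    []   : ∀ {v} → Walk v v
    step : ∀ {u v w} (e : Edge) → Joins e u v → Walk v w → Walk u w

  edges : ∀ {u v} → Walk u v → List Edge
  edges []           = []
  edges (step e _ W) = e ∷ edges W

  innerVerts : ∀ {u v} → Walk u v → List Vertex
  innerVerts []                              = []
  innerVerts (step e _ [])                   = []
  innerVerts (step {v = v} e _ W@(step _ _ _)) = v ∷ innerVerts W

  -- A path from u to v: at least one edge, no repeated edge, no repeated
  -- vertex except that the two endpoints may coincide (closed path / cycle).
  IsPath : ∀ {u v} → Walk u v → Set
  IsPath {u} {v} W =
    1 ≤ length (edges W) × Unique (edges W) × Unique (innerVerts W)
    × u ∉ innerVerts W × v ∉ innerVerts W

  Connected : Set
  Connected = ∀ u v → Walk u v

  TwoEdgeConnected : Set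
  TwoEdgeConnected =
    Connected × (∀ (e : Edge) u v → Σ (Walk u v) (λ W → e ∉ edges W))

  InV : (Edge → Set) → Vertex → Set
  InV H v = ∃[ e ] (H e × Incident e v)

  Degree2 : (Edge → Set) → Vertex → Set
  Degree2 H v = ∃[ e₁ ] ∃[ e₂ ] (e₁ ≢ e₂ × H e₁ × H e₂ × Incident e₁ v × Incident e₂ v
                 × (∀ e → H e → Incident e v → e ≡ e₁ ⊎ e ≡ e₂))

  PathIn : (Edge → Set) → ∀ {u v} → Walk u v → Set
  PathIn H W = IsPath W × All H (edges W)

  Linkish : (Edge → Set) → ∀ {u v} → Walk u v → Set
  Linkish H W = PathIn H W × All (Degree2 H) (innerVerts W)

  IsLink : (Edge → Set) → ∀ {u v} → Walk u v → Set
  IsLink H W = Linkish H W ×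
    (∀ {c d} (W' : Walk c d) → Linkish H W' →
       (∀ e → e ∈ edges W → e ∈ edges W') → (∀ e → e ∈ edges W' → e ∈ edges W))

  IsEar : (Edge → Set) → ∀ {u v} → Walk u v → Set
  IsEar H {u} {v} W = IsPath W × InV H u × InV H v
    × All (λ x → ¬ InV H x) (innerVerts W) × All (λ e → ¬ H e) (edges W)

  IsMaderPath : (Edge → Set) → ∀ {u v} → Walk u v → Set
  IsMaderPath H {u} {v} W = IsEar H W ×
    ¬ (∃[ c ] ∃[ d ] Σ (Walk c d) (λ L → IsLink H L × u ∈ innerVerts L × v ∈ innerVerts L))

  SubdivTheta : (Edge → Set) → Vertex → Vertex → Set
  SubdivTheta H a b = a ≢ b × Σ (Walk a b) λ P₁ → Σ (Walk a b) λ P₂ → Σ (Walk a b) λ P₃ →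
      IsPath P₁ × IsPath P₂ × IsPath P₃
    × (∀ x → x ∈ innerVerts P₁ → x ∉ innerVerts P₂)
    × (∀ x → x ∈ innerVerts P₁ → x ∉ innerVerts P₃)
    × (∀ x → x ∈ innerVerts P₂ → x ∉ innerVerts P₃)
    × (∀ e → e ∈ edges P₁ → e ∉ edges P₂)
    × (∀ e → e ∈ edges P₁ → e ∉ edges P₃)
    × (∀ e → e ∈ edges P₂ → e ∉ edges P₃)
    × (∀ e → H e ⇔ (e ∈ edges P₁ ⊎ e ∈ edges P₂ ⊎ e ∈ edges P₃))

  iter : (Vertex → Vertex) → ℕ → Vertex → Vertex
  iter f zero    x = x
  iter f (suc j) x = f (iter f j x)

  record RootedTree : Set where
    field
      root  : Vertex
      par   : Vertex → Vertex          -- p(v); value at root irrelevant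
      tedge : Vertex → Edge            -- the tree edge {v, p(v)} (v ≠ root)
      depth : Vertex → ℕ               -- witnesses acyclicity
      ord   : Vertex → ℕ               -- DFS discovery number

  module _ (T : RootedTree) where
    open RootedTree T

    _≼_ : Vertex → Vertex → Set
    x ≼ y = ∃[ j ] iter par j y ≡ x

    _≺_ : Vertex → Vertex → Set
    x ≺ y = x ≼ y × x ≢ y

    IsTreeEdge : Edge → Set
    IsTreeEdge e = ∃[ v ] (v ≢ root × tedge v ≡ e)

    -- T is a DFS tree of G rooted at root, and ord is the discovery order
    -- of a depth-first search producing T (= a preorder numbering of T).
    IsDFSTree : Set
    IsDFSTree =
        depth root ≡ 0
      × (∀ v → v ≢ root → depth v ≡ suc (depth (par v)))
      × (∀ v → v ≢ root → Joins (tedge v) v (par v))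
      × (∀ e → ¬ IsTreeEdge e → (end₁ e ≺ end₂ e) ⊎ (end₂ e ≺ end₁ e))
      × (∀ x y → ord x ≡ ord y → x ≡ y)
      × (∀ x y → x ≼ y → ord x ≤ ord y)
      × (∀ x y z → ord x ≤ ord y → ord y ≤ ord z → x ≼ z → x ≼ y)

    -- Chains are indexed 0,1,…,k-1 (chain i is the
    -- paper's C_{i+1}). Chain i consists of the back-edge bedge i from
    -- src i to wend i (src i a proper ancestor of wend i) together with
    -- the tree path from wend i up to tgt i.

    record Chains : Set where
      field
        k     : ℕ
        bedge : ℕ → Edge
        src   : ℕ → Vertex
        wend  : ℕ → Vertex
        tgt   : ℕ → Vertex

    module _ (CD : Chains) where
      open Chains CD

      Inner : ℕ → Vertex → Set
      Inner i u = tgt i ≺ u × u ≼ wend i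

      -- visited at the moment chain i is built
      Visited : ℕ → Vertex → Set
      Visited i u = ord u ≤ ord (src i) ⊎ ∃[ j ] (j < i × Inner j u)

      IsChainDecomposition : Set
      IsChainDecomposition =
          (∀ i → i < k → Joins (bedge i) (src i) (wend i) × src i ≺ wend i)
        × (∀ i → i < k → ¬ IsTreeEdge (bedge i))
        × (∀ i j → i < k → j < k → bedge i ≡ bedge j → i ≡ j)
        × (∀ e → ¬ IsTreeEdge e → ∃[ i ] (i < k × bedge i ≡ e))
        × (∀ i j → i < j → j < k → ord (src i) ≤ ord (src j))
          -- the target is the first visited vertex on the way from wend i to the root
        × (∀ i → i < k → tgt i ≼ wend i × Visited i (tgt i)
                        × (∀ u → Inner i u → ¬ Visited i u))

      ChainEdge : ℕ → Edge → Set
      ChainEdge i e = e ≡ bedge i ⊎ ∃[ u ] (Inner i u × tedge u ≡ e)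

      SBelongs : Vertex → ℕ → Set
      SBelongs v i = (v ≡ root × i ≡ 0) ⊎ (v ≢ root × i < k × Inner i v)

      ParentOf : ℕ → ℕ → Set
      ParentOf D C = D < k × D ≢ 0 × SBelongs (tgt D) C

      InterlacingChild : ℕ → ℕ → Set
      InterlacingChild D C = ParentOf D C × src C ≼ src D × src D ≼ tgt C

      UnionEdges : (ℕ → Set) → Edge → Set
      UnionEdges Gc e = ∃[ i ] (Gc i × ChainEdge i e)

      ParentClosed : (ℕ → Set) → Set
      ParentClosed Gc = (∀ i → Gc i → i < k)
        × (∀ D C → Gc D → ParentOf D C → Gc C)

module Submission where

open import Defs
open import Data.Nat using (ℕ; zero; suc; _≤_; _<_; _+_; _∸_; z≤n; s≤s)
open import Data.Nat.Properties
  using (≤-refl; ≤-trans; ≤-antisym; ≤-total; <-trans; <-irrefl; <-asym; <-cmp; ≤-<-trans; <⇒≤; <⇒≱;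
         ≤∧≢⇒<; n≤1+n; m≤n⇒m<n∨m≡n; suc-injective; m≢1+n+m; m∸n+n≡m)
open import Data.Nat.Induction using (<-wellFounded)
open import Induction.WellFounded using (Acc; acc)
open import Data.Fin using (_≟_)
open import Data.Fin.Properties using (any?)
open import Data.Product using (Σ; _×_; _,_; ∃-syntax; proj₁; proj₂)
open import Data.Sum using (_⊎_; inj₁; inj₂)
open import Data.Empty using (⊥; ⊥-elim)
open import Data.List using (List; []; _∷_)
open import Data.List.Membership.Propositional using (_∈_)
open import Data.List.Relation.Unary.Any using (here; there)
import Data.List.Relation.Unary.All as All
open import Data.List.Relation.Unary.AllPairs using ([]; _∷_)
open import Data.List.Relation.Unary.Unique.Propositional using (Unique)
open import Relation.Nullary using (¬_; Dec; yes; no)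
open import Relation.Nullary.Decidable using (¬?; _×-dec_)
open import Relation.Unary using (Decidable)
open import Relation.Binary.PropositionalEquality using (_≡_; _≢_; refl; sym; trans; cong; subst)
open import Relation.Binary.Definitions using (tri<; tri≈; tri>)
open import Function.Bundles using (_⇔_; mk⇔; Equivalence)

-- Let U be the edge set of G_c, and say x is on G_c if x is the root or an
-- inner vertex of a chain of G_c.
-- (1) By 2-edge-connectivity some back-edge jumps over every non-root
--     vertex, and the DFS visiting order then makes every non-root vertex
--     an inner vertex of some chain ('cover'). With parent-closedness the
--     target of a chain of G_c is on G_c, so the vertices on G_c are closed
--     under tree ancestors and both ends of every U-edge are on G_c.
-- (2) D is the path made of its back-edge and the tree path from wend D up
--     to tgt D; its inner vertices are the inner vertices of chain D.
-- (3) Ear: tgt D s-belongs to C and src D ⊑ tgt C, so both are on G_c.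
--     An inner vertex of D met by a U-edge would be on G_c, i.e. an inner
--     vertex of a chain of G_c, which can only be D; similarly for edges.
-- (4) Mader: the root (branch vertex of the theta graph C₁ ∪ C₂) and the
--     ends of every chain of G_c are branch vertices of G_c, and an inner
--     vertex of degree two of a chain C of G_c has all its G_c-neighbours
--     in C or at its ends. So no link has inner vertices both inside C
--     (like tgt D, unless it is the root) and outside C (like src D).

data Consecutive {A : Set} : List A → A → A → Set where
  first : ∀ {a b xs} → Consecutive (a ∷ b ∷ xs) a b
  later : ∀ {x a b xs} → Consecutive xs a b → Consecutive (x ∷ xs) a b

consecutive-∈ : ∀ {A : Set} {xs : List A} {a b} → Consecutive xs a b → a ∈ xs × b ∈ xs
consecutive-∈ first     = here refl , there (here refl)
consecutive-∈ (later c) with consecutive-∈ c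
... | a∈ , b∈ = there a∈ , there b∈

leaveQ : ∀ {A : Set} {Q : A → Set} → Decidable Q → ∀ {a xs y} → Q a → y ∈ xs → ¬ Q y →
  ∃[ b ] ∃[ c ] (Consecutive (a ∷ xs) b c × Q b × ¬ Q c)
leaveQ Q? {a} {z ∷ zs} qa y∈ ¬qy with Q? z
... | no ¬qz = a , z , first , qa , ¬qz
leaveQ Q? {a} {z ∷ zs} qa (here refl) ¬qy | yes qz = ⊥-elim (¬qy qz)
leaveQ Q? {a} {z ∷ zs} qa (there y∈) ¬qy | yes qz with leaveQ Q? qz y∈ ¬qy
... | b , c , con , qb , ¬qc = b , c , later con , qb , ¬qc

crossing : ∀ {A : Set} {Q : A → Set} → Decidable Q → ∀ {xs x y} → x ∈ xs → Q x → y ∈ xs → ¬ Q y →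
  ∃[ a ] ∃[ b ] ((Consecutive xs a b ⊎ Consecutive xs b a) × Q a × ¬ Q b)
crossing Q? (here refl) qx (here refl) ¬qy = ⊥-elim (¬qy qx)
crossing Q? (here refl) qx (there y∈) ¬qy with leaveQ Q? qx y∈ ¬qy
... | a , b , con , qa , ¬qb = a , b , inj₁ con , qa , ¬qb
crossing Q? (there x∈) qx (here refl) ¬qy with leaveQ (λ z → ¬? (Q? z)) ¬qy x∈ (λ ¬qx → ¬qx qx)
... | b , a , con , ¬qb , ¬¬qa with Q? a
...   | yes qa = a , b , inj₂ con , qa , ¬qb
...   | no ¬qa = ⊥-elim (¬¬qa ¬qa)
crossing Q? (there x∈) qx (there y∈) ¬qy with crossing Q? x∈ qx y∈ ¬qy
... | a , b , inj₁ con , qa , ¬qb = a , b , inj₁ (later con) , qa , ¬qb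
... | a , b , inj₂ con , qa , ¬qb = a , b , inj₂ (later con) , qa , ¬qb

module Incidence (G : Graph) where
  open Graph G

  joins-sym : ∀ {e u v} → Joins G e u v → Joins G e v u
  joins-sym (inj₁ (p , q)) = inj₂ (q , p)
  joins-sym (inj₂ (p , q)) = inj₁ (q , p)

  joins-inc : ∀ {e u v} → Joins G e u v → Incident G e u
  joins-inc (inj₁ (p , _)) = inj₁ p
  joins-inc (inj₂ (p , _)) = inj₂ p

  joins-uniq : ∀ {e a b c d} → Joins G e a b → Joins G e c d → (a ≡ c × b ≡ d) ⊎ (a ≡ d × b ≡ c)
  joins-uniq (inj₁ (p , q)) (inj₁ (r , s)) = inj₁ (trans (sym p) r , trans (sym q) s)
  joins-uniq (inj₁ (p , q)) (inj₂ (r , s)) = inj₂ (trans (sym p) s , trans (sym q) r)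
  joins-uniq (inj₂ (p , q)) (inj₁ (r , s)) = inj₂ (trans (sym p) s , trans (sym q) r)
  joins-uniq (inj₂ (p , q)) (inj₂ (r , s)) = inj₁ (trans (sym p) r , trans (sym q) s)

  incident-end : ∀ {e u a b} → Joins G e a b → Incident G e u → u ≡ a ⊎ u ≡ b
  incident-end (inj₁ (p , q)) (inj₁ r) = inj₁ (trans (sym r) p)
  incident-end (inj₁ (p , q)) (inj₂ r) = inj₂ (trans (sym r) q)
  incident-end (inj₂ (p , q)) (inj₁ r) = inj₂ (trans (sym r) q)
  incident-end (inj₂ (p , q)) (inj₂ r) = inj₁ (trans (sym r) p)

  joins-loop : ∀ {e a} → Joins G e a a → end₁ e ≡ end₂ e
  joins-loop (inj₁ (p , q)) = trans p (sym q)
  joins-loop (inj₂ (p , q)) = trans q (sym p)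

  joins-other : Loopless G → ∀ {e a b c} → Joins G e a b → Joins G e a c → b ≡ c
  joins-other lp {e} j j' with joins-uniq j j'
  ... | inj₁ (_ , b≡c) = b≡c
  ... | inj₂ (_ , b≡a) = ⊥-elim (lp e (joins-loop (subst (Joins G e _) b≡a j)))

  boundary : ∀ {Q : Vertex G → Set} → Decidable Q → ∀ {a b} (W : Walk G a b) → Q a → ¬ Q b →
    ∃[ e ] ∃[ c ] ∃[ d ] (e ∈ edges G W × Joins G e c d × Q c × ¬ Q d)
  boundary Q? []               qa ¬qb = ⊥-elim (¬qb qa)
  boundary Q? (step {v = v} e j W) qa ¬qb with Q? v
  ... | no ¬qv = e , _ , v , here refl , j , qa , ¬qv
  ... | yes qv with boundary Q? W qv ¬qb
  ...   | f , c , d , f∈ , jf , qc , ¬qd = f , c , d , there f∈ , jf , qc , ¬qd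

  consecutive-edge : ∀ {u v a b} (W : Walk G u v) → Consecutive (innerVerts G W) a b →
    ∃[ e ] (e ∈ edges G W × Joins G e a b)
  consecutive-edge (step _ _ (step _ _ [])) (later ())
  consecutive-edge (step _ _ (step e j (step _ _ _))) first = e , there (here refl) , j
  consecutive-edge (step _ _ W@(step _ _ (step _ _ _))) (later c) with consecutive-edge W c
  ... | e , e∈ , j = e , there e∈ , j

  crossing-edge : ∀ {Q : Vertex G → Set} → Decidable Q → ∀ {u v x y} (W : Walk G u v) →
    x ∈ innerVerts G W → Q x → y ∈ innerVerts G W → ¬ Q y →
    ∃[ e ] ∃[ a ] ∃[ b ] (e ∈ edges G W × Joins G e a b × Q a × ¬ Q b
                          × a ∈ innerVerts G W × b ∈ innerVerts G W)
  crossing-edge Q? W x∈ qx y∈ ¬qy with crossing Q? x∈ qx y∈ ¬qy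
  ... | a , b , inj₁ con , qa , ¬qb with consecutive-edge W con | consecutive-∈ con
  ...   | e , e∈ , j | a∈ , b∈ = e , a , b , e∈ , j , qa , ¬qb , a∈ , b∈
  crossing-edge Q? W x∈ qx y∈ ¬qy | a , b , inj₂ con , qa , ¬qb
    with consecutive-edge W con | consecutive-∈ con
  ...   | e , e∈ , j | b∈ , a∈ = e , a , b , e∈ , joins-sym j , qa , ¬qb , a∈ , b∈

  first-edge : ∀ {a b} → a ≢ b → (W : Walk G a b) → ∃[ e ] (e ∈ edges G W × Incident G e a)
  first-edge a≢b []           = ⊥-elim (a≢b refl)
  first-edge a≢b (step e j W) = e , here refl , joins-inc j

  module _ {H : Edge G → Set} {v : Vertex G} where
    degree2-pair : Degree2 G H v → ∀ {f₁ f₂} → f₁ ≢ f₂ → H f₁ → H f₂ →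
      Incident G f₁ v → Incident G f₂ v → ∀ {e} → H e → Incident G e v → e ≡ f₁ ⊎ e ≡ f₂
    degree2-pair (_ , _ , _ , _ , _ , _ , _ , only) f₁≢f₂ h₁ h₂ i₁ i₂ h i
      with only _ h₁ i₁ | only _ h₂ i₂ | only _ h i
    ... | inj₁ p | inj₁ q | _      = ⊥-elim (f₁≢f₂ (trans p (sym q)))
    ... | inj₂ p | inj₂ q | _      = ⊥-elim (f₁≢f₂ (trans p (sym q)))
    ... | inj₁ p | inj₂ q | inj₁ r = inj₁ (trans r (sym p))
    ... | inj₁ p | inj₂ q | inj₂ r = inj₂ (trans r (sym q))
    ... | inj₂ p | inj₁ q | inj₁ r = inj₂ (trans r (sym q))
    ... | inj₂ p | inj₁ q | inj₂ r = inj₁ (trans r (sym p))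

    three-edges : ∀ {f₁ f₂ f₃} → f₁ ≢ f₂ → f₁ ≢ f₃ → f₂ ≢ f₃ → H f₁ → H f₂ → H f₃ →
      Incident G f₁ v → Incident G f₂ v → Incident G f₃ v → ¬ Degree2 G H v
    three-edges n₁₂ n₁₃ n₂₃ h₁ h₂ h₃ i₁ i₂ i₃ deg with degree2-pair deg n₁₂ h₁ h₂ i₁ i₂ h₃ i₃
    ... | inj₁ p = n₁₃ (sym p)
    ... | inj₂ p = n₂₃ (sym p)

  theta-branch-edges : ∀ {H a b} → SubdivTheta G H a b →
    ∃[ f₁ ] ∃[ f₂ ] ∃[ f₃ ] (f₁ ≢ f₂ × f₁ ≢ f₃ × f₂ ≢ f₃ × H f₁ × H f₂ × H f₃
      × Incident G f₁ a × Incident G f₂ a × Incident G f₃ a)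
  theta-branch-edges (a≢b , P₁ , P₂ , P₃ , _ , _ , _ , _ , _ , _ , d₁₂ , d₁₃ , d₂₃ , H⇔)
    with first-edge a≢b P₁ | first-edge a≢b P₂ | first-edge a≢b P₃
  ... | f₁ , f₁∈ , i₁ | f₂ , f₂∈ , i₂ | f₃ , f₃∈ , i₃ =
    f₁ , f₂ , f₃
    , (λ { refl → d₁₂ f₁ f₁∈ f₂∈ }) , (λ { refl → d₁₃ f₁ f₁∈ f₃∈ }) , (λ { refl → d₂₃ f₂ f₂∈ f₃∈ })
    , Equivalence.from (H⇔ f₁) (inj₁ f₁∈)
    , Equivalence.from (H⇔ f₂) (inj₂ (inj₁ f₂∈))
    , Equivalence.from (H⇔ f₃) (inj₂ (inj₂ f₃∈))
    , i₁ , i₂ , i₃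

module TreeOrder (G : Graph) (T : RootedTree G) (dfs : IsDFSTree G T) where
  open Graph G
  open RootedTree T
  open Incidence G

  _⊑_ : Vertex G → Vertex G → Set
  x ⊑ y = _≼_ G T x y

  _⊏_ : Vertex G → Vertex G → Set
  x ⊏ y = _≺_ G T x y

  it : ℕ → Vertex G → Vertex G
  it = iter G par

  depth-root : depth root ≡ 0
  depth-root = proj₁ dfs

  depth-step : ∀ v → v ≢ root → depth v ≡ suc (depth (par v))
  depth-step = proj₁ (proj₂ dfs)

  tree-edge : ∀ v → v ≢ root → Joins G (tedge v) v (par v)
  tree-edge = proj₁ (proj₂ (proj₂ dfs))

  ord-injective : ∀ x y → ord x ≡ ord y → x ≡ y
  ord-injective = proj₁ (proj₂ (proj₂ (proj₂ (proj₂ dfs))))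

  ord-mono : ∀ x y → x ⊑ y → ord x ≤ ord y
  ord-mono = proj₁ (proj₂ (proj₂ (proj₂ (proj₂ (proj₂ dfs)))))

  it-suc : ∀ j y → it (suc j) y ≡ it j (par y)
  it-suc zero    y = refl
  it-suc (suc j) y = cong par (it-suc j y)

  it-+ : ∀ i j y → it (i + j) y ≡ it i (it j y)
  it-+ zero    j y = refl
  it-+ (suc i) j y = cong par (it-+ i j y)

  ⊑-refl : ∀ {x} → x ⊑ x
  ⊑-refl = 0 , refl

  ⊑-reflexive : ∀ {x y} → x ≡ y → x ⊑ y
  ⊑-reflexive refl = ⊑-refl

  ⊑-trans : ∀ {x y z} → x ⊑ y → y ⊑ z → x ⊑ z
  ⊑-trans {z = z} (i , p) (j , q) = i + j , trans (it-+ i j z) (trans (cong (it i) q) p)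

  ⊑-antisym : ∀ {x y} → x ⊑ y → y ⊑ x → x ≡ y
  ⊑-antisym p q = ord-injective _ _ (≤-antisym (ord-mono _ _ p) (ord-mono _ _ q))

  par⊑ : ∀ y → par y ⊑ y
  par⊑ y = 1 , refl

  ⊏⇒⊑par : ∀ {x y} → x ⊏ y → x ⊑ par y
  ⊏⇒⊑par ((zero , p) , x≢y)           = ⊥-elim (x≢y (sym p))
  ⊏⇒⊑par {y = y} ((suc j , p) , _) = j , trans (sym (it-suc j y)) p

  it-⊑ : ∀ {a b z x y} → a ≤ b → it a z ≡ x → it b z ≡ y → y ⊑ x
  it-⊑ {a} {b} {z} a≤b refl q =
    b ∸ a , trans (sym (it-+ (b ∸ a) a z)) (trans (cong (λ t → it t z) (m∸n+n≡m a≤b)) q)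

  ⊑-cmp : ∀ {x y z} → x ⊑ z → y ⊑ z → x ⊑ y ⊎ y ⊑ x
  ⊑-cmp (a , p) (b , q) with ≤-total a b
  ... | inj₁ a≤b = inj₂ (it-⊑ a≤b p q)
  ... | inj₂ b≤a = inj₁ (it-⊑ b≤a q p)

  depth0⇒root : ∀ {v} → depth v ≡ 0 → v ≡ root
  depth0⇒root {v} d with v ≟ root
  ... | yes v≡r = v≡r
  ... | no v≢r with trans (sym (depth-step v v≢r)) d
  ...   | ()

  positive-depth-nonroot : ∀ {y d} → depth y ≡ suc d → y ≢ root
  positive-depth-nonroot dy refl with trans (sym depth-root) dy
  ... | ()

  depth-par-pred : ∀ {y d} → depth y ≡ suc d → depth (par y) ≡ d
  depth-par-pred dy = suc-injective (trans (sym (depth-step _ (positive-depth-nonroot dy))) dy)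

  climb-to-root : ∀ d y → depth y ≡ d → it d y ≡ root
  climb-to-root zero    y dy = depth0⇒root dy
  climb-to-root (suc d) y dy = trans (it-suc d y) (climb-to-root d (par y) (depth-par-pred dy))

  root⊑ : ∀ y → root ⊑ y
  root⊑ y = depth y , climb-to-root (depth y) y refl

  ⊑root : ∀ {x} → x ⊑ root → x ≡ root
  ⊑root p = ⊑-antisym p (root⊑ _)

  par-root : par root ≡ root
  par-root = ⊑root (par⊑ root)

  depth-par≤ : ∀ z → depth (par z) ≤ depth z
  depth-par≤ z with z ≟ root
  ... | yes refl rewrite par-root = ≤-refl
  ... | no z≢r rewrite depth-step z z≢r = n≤1+n _

  depth-par< : ∀ {z} → z ≢ root → depth (par z) < depth z
  depth-par< {z} z≢r = subst (depth (par z) <_) (sym (depth-step z z≢r)) ≤-refl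

  ⊑-depth : ∀ {x y} → x ⊑ y → depth x ≤ depth y
  ⊑-depth {y = y} (j , refl) = climb j
    where
      climb : ∀ j → depth (it j y) ≤ depth y
      climb zero    = ≤-refl
      climb (suc j) = ≤-trans (depth-par≤ (it j y)) (climb j)

  ⊏-nonroot : ∀ {x y} → x ⊏ y → y ≢ root
  ⊏-nonroot (x⊑y , x≢y) refl = x≢y (⊑root x⊑y)

  ⊏-depth : ∀ {x y} → x ⊏ y → depth x < depth y
  ⊏-depth x⊏y = ≤-<-trans (⊑-depth (⊏⇒⊑par x⊏y)) (depth-par< (⊏-nonroot x⊏y))

  ⊑-same-depth : ∀ {x y} → x ⊑ y → depth y ≡ depth x → x ≡ y
  ⊑-same-depth {x} {y} x⊑y d with x ≟ y
  ... | yes x≡y = x≡y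
  ... | no x≢y = ⊥-elim (<-irrefl (sym d) (⊏-depth (x⊑y , x≢y)))

  ¬⊑par : ∀ {x} → x ≢ root → ¬ x ⊑ par x
  ¬⊑par x≢r x⊑p = <⇒≱ (depth-par< x≢r) (⊑-depth x⊑p)

  ⊑-⊏-trans : ∀ {x y z} → x ⊑ y → y ⊏ z → x ⊏ z
  ⊑-⊏-trans x⊑y (y⊑z , y≢z) = ⊑-trans x⊑y y⊑z , λ x≡z → y≢z (⊑-antisym y⊑z (subst (_⊑ _) x≡z x⊑y))

  par⊏ : ∀ {x} → x ≢ root → par x ⊏ x
  par⊏ x≢r = par⊑ _ , λ p≡x → ¬⊑par x≢r (⊑-reflexive (sym p≡x))

  ord-< : ∀ {x y} → x ⊏ y → ord x < ord y
  ord-< (x⊑y , x≢y) = ≤∧≢⇒< (ord-mono _ _ x⊑y) (λ o → x≢y (ord-injective _ _ o))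

  ⊑-dec : ∀ x y → Dec (x ⊑ y)
  ⊑-dec x y = go (depth y) y refl
    where
      go : ∀ d y → depth y ≡ d → Dec (x ⊑ y)
      go d y dy with x ≟ y
      ... | yes refl = yes ⊑-refl
      go zero    y dy | no x≢y with depth0⇒root dy
      ... | refl = no (λ x⊑r → x≢y (⊑root x⊑r))
      go (suc d) y dy | no x≢y with go d (par y) (depth-par-pred dy)
      ... | yes x⊑p = yes (⊑-trans x⊑p (par⊑ y))
      ... | no x⋢p  = no (λ x⊑y → x⋢p (⊏⇒⊑par (x⊑y , x≢y)))

  child-toward : ∀ {x y} → x ⊏ y → ∃[ c ] (par c ≡ x × c ⊑ y × c ≢ root)
  child-toward {x} {y} x⊏y = go (depth y) y refl x⊏y
    where
      go : ∀ d y → depth y ≡ d → x ⊏ y → ∃[ c ] (par c ≡ x × c ⊑ y × c ≢ root)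
      go d y dy x⊏y with par y ≟ x
      ... | yes p≡x = y , p≡x , ⊑-refl , ⊏-nonroot x⊏y
      go zero    y dy x⊏y | no p≢x = ⊥-elim (<-irrefl (sym dy) (≤-<-trans z≤n (⊏-depth x⊏y)))
      go (suc d) y dy x⊏y | no p≢x with go d (par y) (depth-par-pred dy) (⊏⇒⊑par x⊏y , λ x≡p → p≢x (sym x≡p))
      ... | c , pc , c⊑p , c≢r = c , pc , ⊑-trans c⊑p (par⊑ y) , c≢r

  tedge-injective : ∀ {u v} → u ≢ root → v ≢ root → tedge u ≡ tedge v → u ≡ v
  tedge-injective {u} {v} u≢r v≢r e
    with joins-uniq (tree-edge u u≢r) (subst (λ f → Joins G f v (par v)) (sym e) (tree-edge v v≢r))
  ... | inj₁ (u≡v , _) = u≡v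
  ... | inj₂ (u≡pv , pu≡v) = ⊥-elim (<-asym (subst (λ w → depth w < depth u) pu≡v (depth-par< u≢r))
                                             (subst (λ w → depth w < depth v) (sym u≡pv) (depth-par< v≢r)))

  Between : Vertex G → Vertex G → Vertex G → Set
  Between x y z = x ⊏ z × z ⊑ y

  module Step {n x y} (x⊑y : x ⊑ y) (d : depth y ≡ suc n + depth x) where
    y≢root : y ≢ root
    y≢root = positive-depth-nonroot d

    x≢y : x ≢ y
    x≢y refl = m≢1+n+m (depth x) d

    x⊑par : x ⊑ par y
    x⊑par = ⊏⇒⊑par (x⊑y , x≢y)

    depth-par : depth (par y) ≡ n + depth x
    depth-par = depth-par-pred d

  up : ∀ n {x y} → x ⊑ y → depth y ≡ n + depth x → Walk G y x
  up zero    x⊑y d with ⊑-same-depth x⊑y d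
  ... | refl = []
  up (suc n) {y = y} x⊑y d =
    step (tedge y) (tree-edge y y≢root) (up n x⊑par depth-par)
    where open Step x⊑y d

  up-edges : ∀ n {x y e} (x⊑y : x ⊑ y) (d : depth y ≡ n + depth x) →
    e ∈ edges G (up n x⊑y d) → ∃[ z ] (Between x y z × tedge z ≡ e)
  up-edges zero x⊑y d e∈ with ⊑-same-depth x⊑y d
  up-edges zero x⊑y d () | refl
  up-edges (suc n) {y = y} x⊑y d (here refl) = y , ((x⊑y , x≢y) , ⊑-refl) , refl
    where open Step x⊑y d
  up-edges (suc n) {y = y} x⊑y d (there e∈) with up-edges n (Step.x⊑par x⊑y d) (Step.depth-par x⊑y d) e∈
  ... | z , (x⊏z , z⊑p) , tz = z , (x⊏z , ⊑-trans z⊑p (par⊑ y)) , tz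

  up-edges⁻ : ∀ n {x y z} (x⊑y : x ⊑ y) (d : depth y ≡ n + depth x) →
    Between x y z → tedge z ∈ edges G (up n x⊑y d)
  up-edges⁻ zero x⊑y d (x⊏z , z⊑y) with ⊑-same-depth x⊑y d
  ... | refl = ⊥-elim (proj₂ x⊏z (⊑-antisym (proj₁ x⊏z) z⊑y))
  up-edges⁻ (suc n) {y = y} {z} x⊑y d (x⊏z , z⊑y) with z ≟ y
  ... | yes refl = here refl
  ... | no z≢y = there (up-edges⁻ n (Step.x⊑par x⊑y d) (Step.depth-par x⊑y d) (x⊏z , ⊏⇒⊑par (z⊑y , z≢y)))

  up-inner : ∀ n {x y w z e} (j : Joins G e w y) (x⊑y : x ⊑ y) (d : depth y ≡ n + depth x) →
    z ∈ innerVerts G (step e j (up n x⊑y d)) → Between x y z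
  up-inner zero j x⊑y d z∈ with ⊑-same-depth x⊑y d
  up-inner zero j x⊑y d () | refl
  up-inner (suc n) {y = y} j x⊑y d (here refl) = (x⊑y , x≢y) , ⊑-refl
    where open Step x⊑y d
  up-inner (suc n) {y = y} j x⊑y d (there z∈)
    with up-inner n (tree-edge y (Step.y≢root x⊑y d)) (Step.x⊑par x⊑y d) (Step.depth-par x⊑y d) z∈
  ... | x⊏z , z⊑p = x⊏z , ⊑-trans z⊑p (par⊑ y)

  up-edges-unique : ∀ n {x y} (x⊑y : x ⊑ y) (d : depth y ≡ n + depth x) → Unique (edges G (up n x⊑y d))
  up-edges-unique zero x⊑y d with ⊑-same-depth x⊑y d
  ... | refl = []
  up-edges-unique (suc n) {y = y} x⊑y d =
    All.tabulate fresh ∷ up-edges-unique n x⊑par depth-par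
    where
      open Step x⊑y d
      fresh : ∀ {e} → e ∈ edges G (up n x⊑par depth-par) → tedge y ≢ e
      fresh e∈ ty≡e with up-edges n x⊑par depth-par e∈
      ... | z , (x⊏z , z⊑p) , tz≡e =
        ¬⊑par y≢root (subst (_⊑ par y) (tedge-injective (⊏-nonroot x⊏z) y≢root (trans tz≡e (sym ty≡e))) z⊑p)

  up-inner-unique : ∀ n {x y w e} (j : Joins G e w y) (x⊑y : x ⊑ y) (d : depth y ≡ n + depth x) →
    Unique (innerVerts G (step e j (up n x⊑y d)))
  up-inner-unique zero j x⊑y d with ⊑-same-depth x⊑y d
  ... | refl = []
  up-inner-unique (suc n) {y = y} j x⊑y d =
    All.tabulate fresh ∷ up-inner-unique n j' x⊑par depth-par
    where
      open Step x⊑y d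
      j' = tree-edge y y≢root
      fresh : ∀ {z} → z ∈ innerVerts G (step (tedge y) j' (up n x⊑par depth-par)) → y ≢ z
      fresh z∈ refl = ¬⊑par y≢root (proj₂ (up-inner n j' x⊑par depth-par z∈))

module ChainFacts (G : Graph) (T : RootedTree G) (CD : Chains G T)
                  (lp : Loopless G) (tec : TwoEdgeConnected G) (dfs : IsDFSTree G T)
                  (cd : IsChainDecomposition G T CD) where
  open Graph G
  open RootedTree T
  open Chains CD
  open Incidence G
  open TreeOrder G T dfs

  InChain : ℕ → Vertex G → Set
  InChain = Inner G T CD

  back-edge-joins : ∀ i → i < k → Joins G (bedge i) (src i) (wend i)
  back-edge-joins i ik = proj₁ (proj₁ cd i ik)

  src⊏wend : ∀ i → i < k → src i ⊏ wend i
  src⊏wend i ik = proj₂ (proj₁ cd i ik)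

  back-edge-non-tree : ∀ i → i < k → ¬ IsTreeEdge G T (bedge i)
  back-edge-non-tree = proj₁ (proj₂ cd)

  bedge-injective : ∀ i j → i < k → j < k → bedge i ≡ bedge j → i ≡ j
  bedge-injective = proj₁ (proj₂ (proj₂ cd))

  non-tree-is-back-edge : ∀ e → ¬ IsTreeEdge G T e → ∃[ i ] (i < k × bedge i ≡ e)
  non-tree-is-back-edge = proj₁ (proj₂ (proj₂ (proj₂ cd)))

  src-ordered : ∀ i j → i < j → j < k → ord (src i) ≤ ord (src j)
  src-ordered = proj₁ (proj₂ (proj₂ (proj₂ (proj₂ cd))))

  tgt⊑wend : ∀ i → i < k → tgt i ⊑ wend i
  tgt⊑wend i ik = proj₁ (proj₂ (proj₂ (proj₂ (proj₂ (proj₂ cd)))) i ik)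

  target-visited : ∀ i → i < k → Visited G T CD i (tgt i)
  target-visited i ik = proj₁ (proj₂ (proj₂ (proj₂ (proj₂ (proj₂ (proj₂ cd)))) i ik))

  inner-unvisited : ∀ i → i < k → ∀ u → InChain i u → ¬ Visited G T CD i u
  inner-unvisited i ik = proj₂ (proj₂ (proj₂ (proj₂ (proj₂ (proj₂ (proj₂ cd)))) i ik))

  inner-nonroot : ∀ {i u} → InChain i u → u ≢ root
  inner-nonroot (t⊏u , _) = ⊏-nonroot t⊏u

  target-not-inner : ∀ {i} → ¬ InChain i (tgt i)
  target-not-inner ((_ , t≢t) , _) = t≢t refl

  par-of-inner : ∀ {i z} → InChain i z → par z ≡ tgt i ⊎ InChain i (par z)
  par-of-inner {i} {z} (t⊏z , z⊑w) with tgt i ≟ par z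
  ... | yes t≡p = inj₁ (sym t≡p)
  ... | no t≢p = inj₂ ((⊏⇒⊑par t⊏z , t≢p) , ⊑-trans (par⊑ z) z⊑w)

  in-chain? : ∀ i x → Dec (InChain i x)
  in-chain? i x = (⊑-dec (tgt i) x ×-dec ¬? (tgt i ≟ x)) ×-dec ⊑-dec x (wend i)

  src⊑tgt : ∀ i → i < k → src i ⊑ tgt i
  src⊑tgt i ik with ⊑-cmp (proj₁ (src⊏wend i ik)) (tgt⊑wend i ik)
  ... | inj₁ s⊑t = s⊑t
  ... | inj₂ t⊑s with tgt i ≟ src i
  ...   | yes t≡s = ⊑-reflexive (sym t≡s)
  ...   | no t≢s = ⊥-elim (inner-unvisited i ik (src i) ((t⊑s , t≢s) , proj₁ (src⊏wend i ik)) (inj₁ ≤-refl))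

  inner-disjoint : ∀ {i j u} → i < k → j < k → InChain i u → InChain j u → i ≡ j
  inner-disjoint {i} {j} {u} ik jk iu ju with <-cmp i j
  ... | tri< i<j _ _ = ⊥-elim (inner-unvisited j jk u ju (inj₂ (i , i<j , iu)))
  ... | tri≈ _ i≡j _ = i≡j
  ... | tri> _ _ j<i = ⊥-elim (inner-unvisited i ik u iu (inj₂ (j , j<i , ju)))

  chain-edge-disjoint : ∀ {i j e} → i < k → j < k → ChainEdge G T CD i e → ChainEdge G T CD j e → i ≡ j
  chain-edge-disjoint ik jk (inj₁ p) (inj₁ q) = bedge-injective _ _ ik jk (trans (sym p) q)
  chain-edge-disjoint ik jk (inj₁ p) (inj₂ (u , ju , q)) =
    ⊥-elim (back-edge-non-tree _ ik (u , inner-nonroot ju , trans q p))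
  chain-edge-disjoint ik jk (inj₂ (u , iu , q)) (inj₁ p) =
    ⊥-elim (back-edge-non-tree _ jk (u , inner-nonroot iu , trans q p))
  chain-edge-disjoint ik jk (inj₂ (u , iu , p)) (inj₂ (v , jv , q)) =
    inner-disjoint ik jk iu (subst (InChain _) (sym (tedge-injective (inner-nonroot iu) (inner-nonroot jv) (trans p (sym q)))) jv)

  is-tree-edge? : ∀ e → Dec (IsTreeEdge G T e)
  is-tree-edge? e = any? (λ v → ¬? (v ≟ root) ×-dec (tedge v ≟ e))

  leaving-edge : ∀ {x c d e} → Joins G e c d → x ⊑ c → ¬ x ⊑ d →
    e ≡ tedge x ⊎ ∃[ i ] (i < k × src i ⊏ x × x ⊑ wend i)
  leaving-edge {x} {e = e} j x⊑c x⋢d with is-tree-edge? e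
  ... | yes (v , v≢r , refl) with joins-uniq j (tree-edge v v≢r)
  ...   | inj₂ (refl , refl) = ⊥-elim (x⋢d (⊑-trans x⊑c (par⊑ v)))
  ...   | inj₁ (refl , refl) with x ≟ v
  ...     | yes refl = inj₁ refl
  ...     | no x≢v = ⊥-elim (x⋢d (⊏⇒⊑par (x⊑c , x≢v)))
  leaving-edge {x} j x⊑c x⋢d | no non-tree with non-tree-is-back-edge _ non-tree
  ... | i , ik , refl with joins-uniq j (back-edge-joins i ik)
  ...   | inj₁ (refl , refl) = ⊥-elim (x⋢d (⊑-trans x⊑c (proj₁ (src⊏wend i ik))))
  ...   | inj₂ (refl , refl) with ⊑-cmp x⊑c (proj₁ (src⊏wend i ik))
  ...     | inj₁ x⊑s = ⊥-elim (x⋢d x⊑s)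
  ...     | inj₂ s⊑x = inj₂ (i , ik , (s⊑x , λ s≡x → x⋢d (⊑-reflexive (sym s≡x))) , x⊑c)

  -- Since the tree edge of x is not a bridge, some back-edge jumps over x.
  jumping-back-edge : ∀ {x} → x ≢ root → ∃[ i ] (i < k × src i ⊏ x × x ⊑ wend i)
  jumping-back-edge {x} x≢r with proj₂ tec (tedge x) x (par x)
  ... | W , tx∉W with boundary (⊑-dec x) W ⊑-refl (¬⊑par x≢r)
  ...   | e , c , d , e∈W , j , x⊑c , x⋢d with leaving-edge j x⊑c x⋢d
  ...     | inj₁ refl = ⊥-elim (tx∉W e∈W)
  ...     | inj₂ jump = jump

  src-ord-mono : ∀ {i j} → i ≤ j → j < k → ord (src i) ≤ ord (src j)
  src-ord-mono {i} {j} i≤j jk with m≤n⇒m<n∨m≡n i≤j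
  ... | inj₁ i<j = src-ordered i j i<j jk
  ... | inj₂ refl = ≤-refl

  -- A vertex above the target of chain j, discovered after src j, lies
  -- above the end of an earlier chain (the target was visited before j).
  above-target : ∀ {x j} → j < k → ord (src j) < ord x → x ⊑ tgt j → ∃[ j' ] (j' < j × x ⊑ wend j')
  above-target jk s<x x⊑t with target-visited _ jk
  ... | inj₁ t≤s = ⊥-elim (<⇒≱ s<x (≤-trans (ord-mono _ _ x⊑t) t≤s))
  ... | inj₂ (j' , j'<j , t∈j') = j' , j'<j , ⊑-trans x⊑t (proj₂ t∈j')

  cover-from : ∀ {x} j → Acc _<_ j → j < k → ord (src j) < ord x → x ⊑ wend j →
    ∃[ l ] (l < k × InChain l x)
  cover-from {x} j (acc rec) jk s<x x⊑w with ⊑-dec x (tgt j)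
  ... | yes x⊑t with above-target jk s<x x⊑t
  ...   | j' , j'<j , x⊑w' = cover-from j' (rec j'<j) (<-trans j'<j jk)
                               (≤-<-trans (src-ord-mono (<⇒≤ j'<j) jk) s<x) x⊑w'
  cover-from {x} j _ jk _ x⊑w | no x⋢t with ⊑-cmp (tgt⊑wend j jk) x⊑w
  ...   | inj₁ t⊑x = j , jk , (t⊑x , λ t≡x → x⋢t (⊑-reflexive (sym t≡x))) , x⊑w
  ...   | inj₂ x⊑t = ⊥-elim (x⋢t x⊑t)

  cover : ∀ {x} → x ≢ root → ∃[ l ] (l < k × InChain l x)
  cover x≢r with jumping-back-edge x≢r
  ... | i , ik , s⊏x , x⊑w = cover-from i (<-wellFounded i) ik (ord-< s⊏x) x⊑w

  first-target-root : ∀ {w} → w ≢ root → 0 < k → tgt 0 ≡ root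
  first-target-root {w} w≢r 0<k with child-toward (root⊑ w , λ r≡w → w≢r (sym r≡w))
  ... | c , pc≡r , _ , c≢r with jumping-back-edge c≢r
  ...   | i , ik , s⊏c , _ with target-visited 0 0<k
  ...     | inj₂ (_ , () , _)
  ...     | inj₁ t≤s = ord-injective _ _ (≤-antisym t≤root (ord-mono _ _ (root⊑ (tgt 0))))
    where
      srci≡r : src i ≡ root
      srci≡r = ⊑root (subst (src i ⊑_) pc≡r (⊏⇒⊑par s⊏c))
      t≤root : ord (tgt 0) ≤ ord root
      t≤root = ≤-trans t≤s (subst (λ v → ord (src 0) ≤ ord v) srci≡r (src-ord-mono z≤n ik))

  -- For x with tgt i ⊑ x ⊑ wend i, the edge of chain i at x on the side of
  -- wend i: the back-edge if x = wend i, otherwise the tree edge of the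
  -- child of x towards wend i.
  edge-below : ∀ i {x} → i < k → tgt i ⊑ x → x ⊑ wend i →
    ∃[ f ] (ChainEdge G T CD i f × Incident G f x × (x ≢ root → f ≢ tedge x)
            × (∀ {b} → Joins G f x b → InChain i b ⊎ b ≡ src i))
  edge-below i {x} ik t⊑x x⊑w with x ≟ wend i
  ... | yes refl = bedge i , inj₁ refl , joins-inc (joins-sym jb)
                 , (λ x≢r be≡tx → back-edge-non-tree i ik (x , x≢r , sym be≡tx))
                 , (λ j → inj₂ (sym (joins-other lp (joins-sym jb) j)))
    where jb = back-edge-joins i ik
  ... | no x≢w with child-toward (x⊑w , x≢w)
  ...   | c , pc≡x , c⊑w , c≢r = tedge c , inj₂ (c , c∈i , refl) , joins-inc jc
                                , (λ x≢r tc≡tx → c≢x (tedge-injective c≢r x≢r tc≡tx))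
                                , (λ j → inj₁ (subst (InChain i) (joins-other lp jc j) c∈i))
    where
      jc : Joins G (tedge c) x c
      jc = subst (λ v → Joins G (tedge c) v c) pc≡x (joins-sym (tree-edge c c≢r))
      x⊏c : x ⊏ c
      x⊏c = subst (_⊏ c) pc≡x (par⊏ c≢r)
      c≢x : c ≢ x
      c≢x c≡x = proj₂ x⊏c (sym c≡x)
      c∈i : InChain i c
      c∈i = ⊑-⊏-trans t⊑x x⊏c , c⊑w

  module ChainWalk (D : ℕ) (Dk : D < k) where
    private
      gap : ℕ
      gap = depth (wend D) ∸ depth (tgt D)
      t⊑w : tgt D ⊑ wend D
      t⊑w = tgt⊑wend D Dk
      d : depth (wend D) ≡ gap + depth (tgt D)
      d = sym (m∸n+n≡m (⊑-depth t⊑w))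
      jb : Joins G (bedge D) (src D) (wend D)
      jb = back-edge-joins D Dk

    walk : Walk G (src D) (tgt D)
    walk = step (bedge D) jb (up gap t⊑w d)

    walk-edges : ∀ e → e ∈ edges G walk ⇔ ChainEdge G T CD D e
    walk-edges e = mk⇔ to from
      where
        to : e ∈ edges G walk → ChainEdge G T CD D e
        to (here e≡b) = inj₁ e≡b
        to (there e∈) = inj₂ (up-edges gap t⊑w d e∈)
        from : ChainEdge G T CD D e → e ∈ edges G walk
        from (inj₁ e≡b) = here e≡b
        from (inj₂ (u , u∈D , refl)) = there (up-edges⁻ gap t⊑w d u∈D)

    walk-inner : ∀ {x} → x ∈ innerVerts G walk → InChain D x
    walk-inner = up-inner gap jb t⊑w d

    walk-path : IsPath G walk
    walk-path = s≤s z≤n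
              , All.tabulate back-edge-fresh ∷ up-edges-unique gap t⊑w d
              , up-inner-unique gap jb t⊑w d
              , (λ s∈ → src-not-inner (walk-inner s∈))
              , (λ t∈ → target-not-inner (walk-inner t∈))
      where
        back-edge-fresh : ∀ {e} → e ∈ edges G (up gap t⊑w d) → bedge D ≢ e
        back-edge-fresh e∈ refl with up-edges gap t⊑w d e∈
        ... | u , u∈D , tu≡b = back-edge-non-tree D Dk (u , inner-nonroot u∈D , tu≡b)
        src-not-inner : ¬ InChain D (src D)
        src-not-inner ((t⊑s , t≢s) , _) = t≢s (⊑-antisym t⊑s (src⊑tgt D Dk))

module UnionFacts (G : Graph) (T : RootedTree G) (CD : Chains G T)
                  (lp : Loopless G) (tec : TwoEdgeConnected G) (dfs : IsDFSTree G T)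
                  (cd : IsChainDecomposition G T CD)
                  (Gc : ℕ → Set) (pc : ParentClosed G T CD Gc) (g0 : Gc 0) (g1 : Gc 1)
                  (θ : SubdivTheta G (λ e → ChainEdge G T CD 0 e ⊎ ChainEdge G T CD 1 e)
                                   (RootedTree.root T) (Chains.tgt CD 1)) where
  open Graph G
  open RootedTree T
  open Chains CD
  open Incidence G
  open TreeOrder G T dfs
  open ChainFacts G T CD lp tec dfs cd

  U : Edge G → Set
  U = UnionEdges G T CD Gc

  InGc : Vertex G → Set
  InGc x = ∃[ i ] (Gc i × InChain i x)

  -- x is on G_c: the root or an inner vertex of a chain of G_c; by ends-on-Gc
  -- and on-Gc-has-edge these are exactly the vertices met by edges of G_c
  OnGc : Vertex G → Set
  OnGc x = x ≡ root ⊎ InGc x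

  gc-chain : ∀ {i} → Gc i → i < k
  gc-chain = proj₁ pc _

  parent-in-Gc : ∀ {D C} → Gc D → ParentOf G T CD D C → Gc C
  parent-in-Gc = proj₂ pc _ _

  -- The target of a chain of G_c is on G_c: it is the root, or an inner
  -- vertex of some chain, which is then the parent chain and lies in G_c.
  target-on-Gc : ∀ {i} → Gc i → OnGc (tgt i)
  target-on-Gc {zero} g = inj₁ (first-target-root (λ t≡r → proj₁ θ (sym t≡r)) (gc-chain g))
  target-on-Gc {suc i} g with tgt (suc i) ≟ root
  ... | yes t≡r = inj₁ t≡r
  ... | no t≢r with cover t≢r
  ...   | P , Pk , t∈P = inj₂ (P , parent-in-Gc g (gc-chain g , (λ ()) , inj₂ (t≢r , Pk , t∈P)) , t∈P)

  s-belongs-on-Gc : ∀ {x C} → Gc C → SBelongs G T CD x C → OnGc x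
  s-belongs-on-Gc gC (inj₁ (x≡r , _))     = inj₁ x≡r
  s-belongs-on-Gc gC (inj₂ (_ , _ , x∈C)) = inj₂ (_ , gC , x∈C)

  par-on-Gc : ∀ {z} → OnGc z → OnGc (par z)
  par-on-Gc (inj₁ refl) = inj₁ par-root
  par-on-Gc (inj₂ (i , g , z∈i)) with par-of-inner z∈i
  ... | inj₁ p≡t = subst OnGc (sym p≡t) (target-on-Gc g)
  ... | inj₂ p∈i = inj₂ (i , g , p∈i)

  ancestor-on-Gc : ∀ {x y} → OnGc y → x ⊑ y → OnGc x
  ancestor-on-Gc {y = y} on (j , refl) = climb j
    where
      climb : ∀ j → OnGc (it j y)
      climb zero    = on
      climb (suc j) = par-on-Gc (climb j)

  segment-on-Gc : ∀ {i z} → Gc i → tgt i ⊑ z → z ⊑ wend i → OnGc z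
  segment-on-Gc {i} {z} g t⊑z z⊑w with tgt i ≟ z
  ... | yes refl = target-on-Gc g
  ... | no t≢z = inj₂ (i , g , (t⊑z , t≢z) , z⊑w)

  ends-on-Gc : ∀ {e v} → U e → Incident G e v → OnGc v
  ends-on-Gc (i , g , inj₁ refl) inc with incident-end (back-edge-joins i (gc-chain g)) inc
  ... | inj₁ refl = ancestor-on-Gc (target-on-Gc g) (src⊑tgt i (gc-chain g))
  ... | inj₂ refl = segment-on-Gc g (tgt⊑wend i (gc-chain g)) ⊑-refl
  ends-on-Gc (i , g , inj₂ (x , x∈i , refl)) inc with incident-end (tree-edge x (inner-nonroot x∈i)) inc
  ... | inj₁ refl = inj₂ (i , g , x∈i)
  ... | inj₂ refl = par-on-Gc (inj₂ (i , g , x∈i))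

  C₁∪C₂⊆U : ∀ {e} → ChainEdge G T CD 0 e ⊎ ChainEdge G T CD 1 e → U e
  C₁∪C₂⊆U (inj₁ c) = 0 , g0 , c
  C₁∪C₂⊆U (inj₂ c) = 1 , g1 , c

  root-edges : ∃[ f₁ ] ∃[ f₂ ] ∃[ f₃ ] (f₁ ≢ f₂ × f₁ ≢ f₃ × f₂ ≢ f₃ × U f₁ × U f₂ × U f₃
                 × Incident G f₁ root × Incident G f₂ root × Incident G f₃ root)
  root-edges with theta-branch-edges θ
  ... | f₁ , f₂ , f₃ , d₁₂ , d₁₃ , d₂₃ , h₁ , h₂ , h₃ , inc =
    f₁ , f₂ , f₃ , d₁₂ , d₁₃ , d₂₃ , C₁∪C₂⊆U h₁ , C₁∪C₂⊆U h₂ , C₁∪C₂⊆U h₃ , inc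

  root-branch : ¬ Degree2 G U root
  root-branch with root-edges
  ... | _ , _ , _ , d₁₂ , d₁₃ , d₂₃ , u₁ , u₂ , u₃ , i₁ , i₂ , i₃ = three-edges d₁₂ d₁₃ d₂₃ u₁ u₂ u₃ i₁ i₂ i₃

  tedge-in-U : ∀ {x} → InGc x → U (tedge x)
  tedge-in-U (i , g , x∈i) = i , g , inj₂ (_ , x∈i , refl)

  on-Gc-has-edge : ∀ {x} → OnGc x → InV G U x
  on-Gc-has-edge (inj₁ refl) with root-edges
  ... | f₁ , _ , _ , _ , _ , _ , u₁ , _ , _ , i₁ , _ = f₁ , u₁ , i₁
  on-Gc-has-edge (inj₂ x∈) = _ , tedge-in-U x∈ , joins-inc (tree-edge _ (inner-nonroot (proj₂ (proj₂ x∈))))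

  on-Gc-nonroot : ∀ {x} → OnGc x → x ≢ root → InGc x
  on-Gc-nonroot (inj₁ x≡r) x≢r = ⊥-elim (x≢r x≡r)
  on-Gc-nonroot (inj₂ x∈)  _   = x∈

  -- The target of a chain C of G_c is a branch vertex of G_c: besides
  -- the root case, it has its tree edge and one downward edge in each of
  -- C and the chain P containing it.
  target-branch : ∀ {C} → Gc C → ¬ Degree2 G U (tgt C)
  target-branch {C} gC with target-on-Gc gC
  ... | inj₁ t≡r = subst (λ v → ¬ Degree2 G U v) (sym t≡r) root-branch
  ... | inj₂ (P , gP , t∈P@(t⊏t , t⊑w))
    with edge-below P (gc-chain gP) (proj₁ t⊏t) t⊑w | edge-below C (gc-chain gC) ⊑-refl (tgt⊑wend C (gc-chain gC))
  ...   | f₂ , f₂∈P , i₂ , f₂≢t , _ | f₃ , f₃∈C , i₃ , _ , _ =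
    three-edges (λ t≡f₂ → f₂≢t t≢r (sym t≡f₂)) (λ { refl → P≢C (inj₂ (_ , t∈P , refl)) f₃∈C })
                (λ { refl → P≢C f₂∈P f₃∈C })
                (tedge-in-U (P , gP , t∈P)) (P , gP , f₂∈P) (C , gC , f₃∈C)
                (joins-inc (tree-edge _ t≢r)) i₂ i₃
    where
      t≢r : tgt C ≢ root
      t≢r = inner-nonroot t∈P
      P≢C : ∀ {f} → ChainEdge G T CD P f → ChainEdge G T CD C f → ⊥
      P≢C f∈P f∈C with chain-edge-disjoint (gc-chain gP) (gc-chain gC) f∈P f∈C
      ... | refl = target-not-inner t∈P

  -- The source of a chain C of G_c is a branch vertex of G_c: apart from
  -- the cases source = target or root, it meets the back-edge of C, its
  -- own tree edge and the tree edge of its child towards tgt C.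
  source-branch : ∀ {C} → Gc C → ¬ Degree2 G U (src C)
  source-branch {C} gC with src C ≟ tgt C | src C ≟ root
  ... | yes s≡t | _ = subst (λ v → ¬ Degree2 G U v) (sym s≡t) (target-branch gC)
  ... | no _ | yes s≡r = subst (λ v → ¬ Degree2 G U v) (sym s≡r) root-branch
  ... | no s≢t | no s≢r with child-toward (src⊑tgt C (gc-chain gC) , s≢t)
  ...   | c , pc≡s , c⊑t , c≢r =
    three-edges (not-tree s≢r) (not-tree c≢r) (λ ts≡tc → proj₂ s⊏c (tedge-injective s≢r c≢r ts≡tc))
                (C , gC , inj₁ refl) (tedge-in-U (on-Gc-nonroot (below-target (src⊑tgt C Ck)) s≢r))
                (tedge-in-U (on-Gc-nonroot (below-target c⊑t) c≢r))
                (joins-inc (back-edge-joins C Ck)) (joins-inc (tree-edge _ s≢r))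
                (subst (Incident G (tedge c)) pc≡s (joins-inc (joins-sym (tree-edge c c≢r))))
    where
      Ck = gc-chain gC
      s⊏c : src C ⊏ c
      s⊏c = subst (_⊏ c) pc≡s (par⊏ c≢r)
      below-target : ∀ {x} → x ⊑ tgt C → OnGc x
      below-target = ancestor-on-Gc (target-on-Gc gC)
      not-tree : ∀ {x} → x ≢ root → bedge C ≢ tedge x
      not-tree x≢r b≡t = back-edge-non-tree C Ck (_ , x≢r , sym b≡t)

  chain-neighbour : ∀ {C a b e} → Gc C → InChain C a → Degree2 G U a → U e → Joins G e a b →
    InChain C b ⊎ b ≡ src C ⊎ b ≡ tgt C
  chain-neighbour {C} {a} {b} {e} gC a∈C deg ue j
    with edge-below C (gc-chain gC) (proj₁ (proj₁ a∈C)) (proj₂ a∈C)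
  ... | f , f∈C , i-f , f≢ta , other
    with degree2-pair deg (λ ta≡f → f≢ta a≢r (sym ta≡f)) (tedge-in-U (C , gC , a∈C)) (C , gC , f∈C)
                      (joins-inc (tree-edge a a≢r)) i-f ue (joins-inc j)
    where a≢r = inner-nonroot a∈C
  ...   | inj₂ refl with other j
  ...     | inj₁ b∈C = inj₁ b∈C
  ...     | inj₂ b≡s = inj₂ (inj₁ b≡s)
  chain-neighbour {C} {a} {b} gC a∈C deg ue j | _ | inj₁ refl
    with par-of-inner a∈C | joins-other lp j (tree-edge a (inner-nonroot a∈C))
  ...     | inj₁ p≡t | refl = inj₂ (inj₂ p≡t)
  ...     | inj₂ p∈C | refl = inj₁ p∈C

  -- No link of G_c has inner vertices both inside and outside a chain C
  -- of G_c: an edge of the link crossing from C would end in src C or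
  -- tgt C, which are branch vertices.
  no-link-across : ∀ {C x y c d} → Gc C → InChain C x → ¬ InChain C y →
    (L : Walk G c d) → Linkish G U L → x ∈ innerVerts G L → y ∈ innerVerts G L → ⊥
  no-link-across gC x∈C y∉C L ((_ , all-U) , all-deg2) x∈L y∈L
    with crossing-edge (in-chain? _) L x∈L x∈C y∈L y∉C
  ... | e , a , b , e∈L , j , a∈C , b∉C , a∈L , b∈L
    with chain-neighbour gC a∈C (All.lookup all-deg2 a∈L) (All.lookup all-U e∈L) j
  ...   | inj₁ b∈C = b∉C b∈C
  ...   | inj₂ (inj₁ refl) = source-branch gC (All.lookup all-deg2 b∈L)
  ...   | inj₂ (inj₂ refl) = target-branch gC (All.lookup all-deg2 b∈L)

  outside-vertex : ∀ {D u} → D < k → ¬ Gc D → InChain D u → ¬ InV G U u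
  outside-vertex Dk D∉Gc u∈D (e , ue , inc) with ends-on-Gc ue inc
  ... | inj₁ u≡r = inner-nonroot u∈D u≡r
  ... | inj₂ (i , g , u∈i) with inner-disjoint (gc-chain g) Dk u∈i u∈D
  ...   | refl = D∉Gc g

  outside-edge : ∀ {D e} → D < k → ¬ Gc D → ChainEdge G T CD D e → ¬ U e
  outside-edge Dk D∉Gc e∈D (i , g , e∈i) with chain-edge-disjoint (gc-chain g) Dk e∈i e∈D
  ... | refl = D∉Gc g

  no-link-between : ∀ {C x y c d} → Gc C → SBelongs G T CD x C → y ⊑ tgt C →
    (L : Walk G c d) → Linkish G U L → x ∈ innerVerts G L → y ∈ innerVerts G L → ⊥
  no-link-between gC (inj₁ (refl , _)) _ L link x∈L _ = root-branch (All.lookup (proj₂ link) x∈L)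
  no-link-between gC (inj₂ (_ , _ , x∈C)) y⊑t L link x∈L y∈L =
    no-link-across gC x∈C y∉C L link x∈L y∈L
    where
      y∉C : ¬ InChain _ _
      y∉C (t⊏y , _) = proj₂ t⊏y (⊑-antisym (proj₁ t⊏y) y⊑t)

lemma4 : (G : Graph) (T : RootedTree G) (CD : Chains G T) →
    Loopless G → MinDegree3 G → TwoEdgeConnected G →
    IsDFSTree G T → IsChainDecomposition G T CD →
    2 ≤ Chains.k CD →
    SubdivTheta G (λ e → ChainEdge G T CD 0 e ⊎ ChainEdge G T CD 1 e)
      (RootedTree.root T) (Chains.tgt CD 1) →
    (Gc : ℕ → Set) → ParentClosed G T CD Gc → Gc 0 → Gc 1 →
    (C D : ℕ) → Gc C → InterlacingChild G T CD D C → ¬ Gc D →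
    Σ (Walk G (Chains.src CD D) (Chains.tgt CD D)) (λ W →
      (∀ e → e ∈ edges G W ⇔ ChainEdge G T CD D e)
      × IsMaderPath G (UnionEdges G T CD Gc) W)
lemma4 G T CD lp _ tec dfs cd _ θ Gc pc g0 g1 C D gC ((Dk , _ , tD-in-C) , _ , sD⊑tC) D∉Gc =
  walk , walk-edges , ear , no-link
  where
    open TreeOrder G T dfs
    open ChainFacts G T CD lp tec dfs cd
    open UnionFacts G T CD lp tec dfs cd Gc pc g0 g1 θ
    open ChainWalk D Dk

    ear : IsEar G U walk
    ear = walk-path
        , on-Gc-has-edge (ancestor-on-Gc (target-on-Gc gC) sD⊑tC)
        , on-Gc-has-edge (s-belongs-on-Gc gC tD-in-C)
        , All.tabulate (λ x∈ → outside-vertex Dk D∉Gc (walk-inner x∈))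
        , All.tabulate (λ e∈ → outside-edge Dk D∉Gc (Equivalence.to (walk-edges _) e∈))

    no-link : ¬ (∃[ c ] ∃[ d ] Σ (Walk G c d) (λ L → IsLink G U L
                × Chains.src CD D ∈ innerVerts G L × Chains.tgt CD D ∈ innerVerts G L))
    no-link (_ , _ , L , (link , _) , s∈L , t∈L) = no-link-between gC tD-in-C sD⊑tC L link t∈L s∈L
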